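{- Let $\mathcal F$ be a group pair. Suppose that $\varphi_{yx}=\varphi_{xy}^{ -1}$ for all $(x,y)\in\mathcal E$. Suppose also that $\varphi_{xy}[H_{xy}\circ H_{xz}]=K_{xy}\circ H_{yz}$ for all $(x,y),(y,z)\in\mathcal E$. Then for all $(x,y),(y,z)\in\mathcal E$, $$\varphi_{yz}[K_{xy}\circ H_{yz}]=K_{xz}\circ K_{yz}\quad\text{and}\quad\varphi_{xz}[H_{xy}\circ H_{xz}]=K_{xz}\circ K_{yz}.$$
   Context: A group pair consists of the following data. - Pairwise disjoint groups $G_x$ ($x\in I$). - An equivalence relation $\mathcal E$ on $I$. - For each $(x,y)\in\mathcal E$, an isomorphism $\varphi_{xy}:G_x/H_{xy}\to G_y/K_{xy}$, where $H_{xy}\trianglelefteq G_x$ and $K_{xy}\trianglelefteq G_y$. $X\circ Y$ denotes the complex product. For $S\subseteq G_x$ a union of cosets of $H_{xy}$, $\varphi_{xy}[S]$ denotes the union of the images $\varphi_{xy}(H)$ of the cosets $H\subseteq S$. -}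

module Defs where

open import Level using (Level; _⊔_; suc)
open import Data.Product using (Σ; ∃; ∃-syntax; _×_; _,_)
open import Relation.Binary.PropositionalEquality using (_≡_)
open import Relation.Binary.Structures using (IsEquivalence)
open import Algebra.Bundles using (Group)

Subset : ∀ {a} (A : Set a) (p : Level) → Set (a ⊔ suc p)
Subset A p = A → Set p

_≐_ : ∀ {a p q} {A : Set a} → (A → Set p) → (A → Set q) → Set (a ⊔ p ⊔ q)
S ≐ T = ∀ g → (S g → T g) × (T g → S g)

module _ {c ℓ} (G : Group c ℓ) where
  open Group G

  record NormalSubgroup (p : Level) : Set (c ⊔ ℓ ⊔ suc p) where
    field
      mem    : Carrier → Set p
      resp   : ∀ {x y} → x ≈ y → mem x → mem y
      ε∈     : mem ε
      ∙-cl   : ∀ {x y} → mem x → mem y → mem (x ∙ y)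
      ⁻¹-cl  : ∀ {x} → mem x → mem (x ⁻¹)
      normal : ∀ g {x} → mem x → mem ((g ∙ x) ∙ g ⁻¹)

  _∘ᶜ_ : ∀ {p q} → (Carrier → Set p) → (Carrier → Set q) → Carrier → Set (c ⊔ ℓ ⊔ p ⊔ q)
  (X ∘ᶜ Y) g = ∃[ a ] ∃[ b ] (X a × Y b × g ≈ a ∙ b)

  SameCoset : ∀ {p} → NormalSubgroup p → Carrier → Carrier → Set p
  SameCoset N x y = NormalSubgroup.mem N (x ⁻¹ ∙ y)

-- An isomorphism of quotient groups G/N → G'/M, presented by a lift
-- f : G → G' acting on coset representatives (gN ↦ f(g)M).
record QuotientIso {c ℓ c' ℓ' p q} (G : Group c ℓ) (G' : Group c' ℓ')
       (N : NormalSubgroup G p) (M : NormalSubgroup G' q)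
       : Set (c ⊔ ℓ ⊔ c' ⊔ ℓ' ⊔ p ⊔ q) where
  private
    module G = Group G
    module G' = Group G'
  field
    f         : G.Carrier → G'.Carrier
    wd        : ∀ {x y} → SameCoset G N x y → SameCoset G' M (f x) (f y)
    hom       : ∀ x y → SameCoset G' M (f (x G.∙ y)) (f x G'.∙ f y)
    inj       : ∀ {x y} → SameCoset G' M (f x) (f y) → SameCoset G N x y
    surj      : ∀ h → ∃[ g ] SameCoset G' M (f g) h

  -- φ[S]: union of the images φ(gN) of the cosets gN ⊆ S.  For S a union
  -- of cosets of N this is { h | ∃ g ∈ S, h ∈ f(g)M }.
  image : ∀ {s} → (G.Carrier → Set s) → G'.Carrier → Set (c ⊔ s ⊔ q)
  image S h = ∃[ g ] (S g × SameCoset G' M (f g) h)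

record GroupPair (i e c ℓ p : Level) : Set (suc (i ⊔ e ⊔ c ⊔ ℓ ⊔ p)) where
  field
    I      : Set i
    G      : I → Group c ℓ
    E      : I → I → Set e
    E-equiv : IsEquivalence E
    -- E is a relation (a subset of I × I): proofs of membership are unique
    E-prop : ∀ {x y} (r s : E x y) → r ≡ s
    H      : ∀ {x y} → E x y → NormalSubgroup (G x) p
    K      : ∀ {x y} → E x y → NormalSubgroup (G y) p
    φ      : ∀ {x y} (r : E x y) → QuotientIso (G x) (G y) (H r) (K r)

module GP {i e c ℓ p} (F : GroupPair i e c ℓ p) where
  open GroupPair F public
  mH : ∀ {x y} → E x y → Group.Carrier (G x) → Set p
  mH r = NormalSubgroup.mem (H r)
  mK : ∀ {x y} → E x y → Group.Carrier (G y) → Set p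
  mK r = NormalSubgroup.mem (K r)
  fφ : ∀ {x y} → E x y → Group.Carrier (G x) → Group.Carrier (G y)
  fφ r = QuotientIso.f (φ r)
  img : ∀ {x y} (r : E x y) {s} → (Group.Carrier (G x) → Set s) → Group.Carrier (G y) → Set (c ⊔ s ⊔ p)
  img r S = QuotientIso.image (φ r) S
  prod : ∀ x {q s} → (Group.Carrier (G x) → Set q) → (Group.Carrier (G x) → Set s) → Group.Carrier (G x) → Set (c ⊔ ℓ ⊔ q ⊔ s)
  prod x = _∘ᶜ_ (G x)

  -- φ_yx = φ_xy⁻¹ : the domain G_y/H_yx equals G_y/K_xy, the codomain
  -- G_x/K_yx equals G_x/H_xy, and the two maps are mutually inverse.
  InverseHyp : Set (i ⊔ e ⊔ c ⊔ p)
  InverseHyp = ∀ {x y} (r : E x y) (s : E y x) →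
      (mH s ≐ mK r) × (mK s ≐ mH r)
    × (∀ g → SameCoset (G x) (H r) (fφ s (fφ r g)) g)
    × (∀ h → SameCoset (G y) (K r) (fφ r (fφ s h)) h)

  ProductHyp : Set (i ⊔ e ⊔ c ⊔ ℓ ⊔ p)
  ProductHyp = ∀ {x y z} (r : E x y) (s : E y z) (t : E x z) →
    img r (prod x (mH r) (mH t)) ≐ prod y (mK r) (mH s)

  Conclusion : Set (i ⊔ e ⊔ c ⊔ ℓ ⊔ p)
  Conclusion = ∀ {x y z} (r : E x y) (s : E y z) (t : E x z) →
      (img s (prod y (mK r) (mH s)) ≐ prod z (mK t) (mK s))
    × (img t (prod x (mH r) (mH t)) ≐ prod z (mK t) (mK s))

module Submission where

-- Both conclusions are instances of the product hypothesis
-- read along a different pair of edges, once two facts are available: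
--   (1) φ_yx = φ_xy⁻¹ identifies H_yx with K_xy (as subsets of G_y), and
--   (2) if N is a normal subgroup then N ∘ B = B ∘ N for every subset B.
-- For the first conclusion apply the hypothesis to (y,z),(z,x):
--   φ_yz[K_xy ∘ H_yz] = φ_yz[H_yz ∘ H_yx] = K_yz ∘ H_zx = K_yz ∘ K_xz = K_xz ∘ K_yz;
-- for the second apply it to (x,z),(z,y):
--   φ_xz[H_xy ∘ H_xz] = φ_xz[H_xz ∘ H_xy] = K_xz ∘ H_zy = K_xz ∘ K_yz.

open import Defs
open import Data.Product using (_,_; proj₁; proj₂)
open import Relation.Binary.Structures using (IsEquivalence)
open import Algebra.Bundles using (Group)
import Algebra.Properties.Group as GroupProperties
import Relation.Binary.Reasoning.Setoid as SetoidReasoning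

module _ {a} {A : Set a} where

  ≐-refl : ∀ {p} {S : A → Set p} → S ≐ S
  ≐-refl g = (λ s → s) , (λ s → s)

  ≐-sym : ∀ {p q} {S : A → Set p} {T : A → Set q} → S ≐ T → T ≐ S
  ≐-sym S≐T g = proj₂ (S≐T g) , proj₁ (S≐T g)

  ≐-trans : ∀ {p q r} {S : A → Set p} {T : A → Set q} {U : A → Set r} →
            S ≐ T → T ≐ U → S ≐ U
  ≐-trans S≐T T≐U g =
    (λ s → proj₁ (T≐U g) (proj₁ (S≐T g) s)) ,
    (λ u → proj₂ (S≐T g) (proj₂ (T≐U g) u))

-- Chains  S ≐⟨ … ⟩ T ≐⟨ … ⟩ U ∎  of subset equalities; the subsets may
-- live at different universe levels, so the stdlib reasoning kit does
-- not apply directly.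
module ≐-Reasoning {a} {A : Set a} where
  infixr 2 _≐⟨_⟩_
  infix  3 _∎

  _≐⟨_⟩_ : ∀ {p q r} (S : A → Set p) {T : A → Set q} {U : A → Set r} →
           S ≐ T → T ≐ U → S ≐ U
  S ≐⟨ S≐T ⟩ T≐U = ≐-trans S≐T T≐U

  _∎ : ∀ {p} (S : A → Set p) → S ≐ S
  S ∎ = ≐-refl

module _ {c ℓ} (G : Group c ℓ) where
  open Group G
  open GroupProperties G using (⁻¹-involutive)
  open SetoidReasoning setoid

  ∘ᶜ-cong : ∀ {p p' q q'} {X : Carrier → Set p} {X' : Carrier → Set p'}
            {Y : Carrier → Set q} {Y' : Carrier → Set q'} →
            X ≐ X' → Y ≐ Y' → _∘ᶜ_ G X Y ≐ _∘ᶜ_ G X' Y'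
  ∘ᶜ-cong X≐X' Y≐Y' g =
    (λ { (a , b , a∈X , b∈Y , g≈ab) →
           a , b , proj₁ (X≐X' a) a∈X , proj₁ (Y≐Y' b) b∈Y , g≈ab }) ,
    (λ { (a , b , a∈X' , b∈Y' , g≈ab) →
           a , b , proj₂ (X≐X' a) a∈X' , proj₂ (Y≐Y' b) b∈Y' , g≈ab })

  -- A normal subgroup commutes with every subset under the complex
  -- product: a ∙ b = b ∙ (b⁻¹ a b) and b ∙ a = (b a b⁻¹) ∙ b.
  normal-∘ᶜ-comm : ∀ {p q} (N : NormalSubgroup G p) (B : Carrier → Set q) →
                   _∘ᶜ_ G (NormalSubgroup.mem N) B ≐ _∘ᶜ_ G B (NormalSubgroup.mem N)
  normal-∘ᶜ-comm N B g = NB⊆BN , BN⊆NB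
    where
    open NormalSubgroup N

    conjugate-right : ∀ a b → b ∙ ((b ⁻¹ ∙ a) ∙ b) ≈ a ∙ b
    conjugate-right a b = begin
      b ∙ ((b ⁻¹ ∙ a) ∙ b) ≈⟨ sym (assoc _ _ _) ⟩
      (b ∙ (b ⁻¹ ∙ a)) ∙ b ≈⟨ ∙-congʳ (sym (assoc _ _ _)) ⟩
      ((b ∙ b ⁻¹) ∙ a) ∙ b ≈⟨ ∙-congʳ (∙-congʳ (inverseʳ b)) ⟩
      (ε ∙ a) ∙ b          ≈⟨ ∙-congʳ (identityˡ a) ⟩
      a ∙ b                ∎

    conjugate-left : ∀ a b → ((a ∙ b) ∙ a ⁻¹) ∙ a ≈ a ∙ b
    conjugate-left a b = begin
      ((a ∙ b) ∙ a ⁻¹) ∙ a ≈⟨ assoc _ _ _ ⟩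
      (a ∙ b) ∙ (a ⁻¹ ∙ a) ≈⟨ ∙-congˡ (inverseˡ a) ⟩
      (a ∙ b) ∙ ε          ≈⟨ identityʳ _ ⟩
      a ∙ b                ∎

    NB⊆BN : _∘ᶜ_ G mem B g → _∘ᶜ_ G B mem g
    NB⊆BN (a , b , a∈N , b∈B , g≈ab) =
      b , (b ⁻¹ ∙ a) ∙ b , b∈B ,
      resp (∙-congˡ (⁻¹-involutive b)) (normal (b ⁻¹) a∈N) ,
      trans g≈ab (sym (conjugate-right a b))

    BN⊆NB : _∘ᶜ_ G B mem g → _∘ᶜ_ G mem B g
    BN⊆NB (a , b , a∈B , b∈N , g≈ab) =
      (a ∙ b) ∙ a ⁻¹ , a , normal a b∈N , a∈B ,
      trans g≈ab (sym (conjugate-left a b))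

image-cong : ∀ {c ℓ c' ℓ' p q s t} {G : Group c ℓ} {G' : Group c' ℓ'}
             {N : NormalSubgroup G p} {M : NormalSubgroup G' q}
             (φ : QuotientIso G G' N M)
             {S : Group.Carrier G → Set s} {T : Group.Carrier G → Set t} →
             S ≐ T → QuotientIso.image φ S ≐ QuotientIso.image φ T
image-cong φ S≐T h =
  (λ { (g , g∈S , fg~h) → g , proj₁ (S≐T g) g∈S , fg~h }) ,
  (λ { (g , g∈T , fg~h) → g , proj₂ (S≐T g) g∈T , fg~h })

lemma3p12 : ∀ {i e c ℓ p} (F : GroupPair i e c ℓ p) →
    GP.InverseHyp F → GP.ProductHyp F → GP.Conclusion F
lemma3p12 F inverse product {x} {y} {z} r s t = first , second
  where
  open GP F
  open IsEquivalence E-equiv using () renaming (sym to reverse)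
  open ≐-Reasoning

  reversed-H : ∀ {a b} (u : E a b) → mH (reverse u) ≐ mK u
  reversed-H u = proj₁ (inverse u (reverse u))

  first : img s (prod y (mK r) (mH s)) ≐ prod z (mK t) (mK s)
  first =
    img s (prod y (mK r) (mH s))
      ≐⟨ image-cong (φ s) (≐-sym (normal-∘ᶜ-comm (G y) (H s) (mK r))) ⟩
    img s (prod y (mH s) (mK r))
      ≐⟨ image-cong (φ s) (∘ᶜ-cong (G y) ≐-refl (≐-sym (reversed-H r))) ⟩
    img s (prod y (mH s) (mH (reverse r)))
      ≐⟨ product s (reverse t) (reverse r) ⟩
    prod z (mK s) (mH (reverse t))
      ≐⟨ ∘ᶜ-cong (G z) ≐-refl (reversed-H t) ⟩
    prod z (mK s) (mK t)
      ≐⟨ normal-∘ᶜ-comm (G z) (K s) (mK t) ⟩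
    prod z (mK t) (mK s) ∎

  second : img t (prod x (mH r) (mH t)) ≐ prod z (mK t) (mK s)
  second =
    img t (prod x (mH r) (mH t))
      ≐⟨ image-cong (φ t) (≐-sym (normal-∘ᶜ-comm (G x) (H t) (mH r))) ⟩
    img t (prod x (mH t) (mH r))
      ≐⟨ product t (reverse s) r ⟩
    prod z (mK t) (mH (reverse s))
      ≐⟨ ∘ᶜ-cong (G z) ≐-refl (reversed-H s) ⟩
    prod z (mK t) (mK s) ∎
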